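{- Let $e$ be either $f$ or $h$ as defined in the context. Then for every fixed integer $k\geq 1$, \[ \liminf_{n\to\infty} e(n)^{1/n}\ \geq\ (2e(k))^{1/k}. \]
   Context: Let $X=[n]=\{1,\dots,n\}$ be a set of alternatives and $\mathcal{L}(X)$ the set of linear orders on $X$. A domain is a subset $\mathcal{D}\subseteq\mathcal{L}(X)$. It is a Condorcet domain if for every profile consisting of an odd number of voters, each with a preference order from $\mathcal{D}$, the pairwise majority relation is transitive. Never conditions: for a triple of alternatives $a<b<c$ (ordered by the societal axis $1<2<\dots<n$), and $i,j\in\{1,2,3\}$, the condition $iNj$ on that triple means that in every order of the domain, the $i$-th smallest element of the triple does not occupy position $j$ among the three (position 1 = most preferred). A Condorcet domain is peak-pit if it equals the set of all linear orders satisfying a complete assignment of never conditions (one for each triple) in which every never condition is of the form $iN1$ or $iN3$ with $i\in\{1,2,3\}$. Define $f(n)=\max\{|\mathcal{D}| : \mathcal{D}$ a Condorcet domain on $n$ alternatives$\}$ and $h(n)=\max\{|\mathcal{D}| : \mathcal{D}$ a peak-pit Condorcet domain on $n$ alternatives$\}$. -}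

module Defs where

open import Data.Nat using (ℕ; zero; suc; _+_; _*_; _^_; _≤_; _<_)
open import Data.Fin using (Fin) renaming (_<_ to _<ᶠ_)
open import Data.Fin.Properties using (_≟_)
open import Data.Vec using (Vec; toList)
open import Data.List using (List; []; _∷_; length)
open import Data.List.Relation.Unary.All using (All)
open import Data.List.Relation.Unary.Unique.Propositional using (Unique)
open import Data.List.Membership.Propositional using (_∈_)
open import Data.Bool using (Bool; true; false; if_then_else_)
open import Data.Product using (Σ; ∃; _×_; _,_)
open import Relation.Nullary using (¬_; yes; no)
open import Relation.Binary.PropositionalEquality using (_≡_)

-- A linear order on X = Fin n (alternatives 1..n are 0..n-1), written as the
-- list of alternatives from most preferred (index 0) to least preferred.
Order : ℕ → Set
Order n = Vec (Fin n) n

IsLinOrder : ∀ {n} → Order n → Set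
IsLinOrder v = Unique (toList v)

prefB : ∀ {n} → List (Fin n) → Fin n → Fin n → Bool
prefB [] x y = false
prefB (z ∷ zs) x y with z ≟ x | z ≟ y
... | yes _ | _     = true
... | no _  | yes _ = false
... | no _  | no _  = prefB zs x y

Prefers : ∀ {n} → Order n → Fin n → Fin n → Set
Prefers v x y = prefB (toList v) x y ≡ true

IsDomain : (n : ℕ) → List (Order n) → Set
IsDomain n D = All IsLinOrder D × Unique D

countPref : ∀ {n} → List (Order n) → Fin n → Fin n → ℕ
countPref [] x y = 0
countPref (v ∷ P) x y = (if prefB (toList v) x y then 1 else 0) + countPref P x y

Maj : ∀ {n} → List (Order n) → Fin n → Fin n → Set
Maj P x y = countPref P y x < countPref P x y

MajTransitive : ∀ {n} → List (Order n) → Set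
MajTransitive {n} P = (x y z : Fin n) → Maj P x y → Maj P y z → Maj P x z

Odd : ℕ → Set
Odd m = ∃ λ j → m ≡ suc (2 * j)

IsCondorcet : (n : ℕ) → List (Order n) → Set
IsCondorcet n D =
  IsDomain n D ×
  ((P : List (Order n)) → All (_∈ D) P → Odd (length P) → MajTransitive P)

-- Never conditions of peak-pit type: iN1 (top) or iN3 (bottom)
data End : Set where
  top bottom : End

-- for a triple a<b<c and i ∈ {1,2,3} (Fin 3), the i-th smallest element and the other two
pick : ∀ {n} → Fin 3 → Fin n → Fin n → Fin n → Fin n × Fin n × Fin n
pick Fin.zero a b c = a , b , c
pick (Fin.suc Fin.zero) a b c = b , a , c
pick (Fin.suc (Fin.suc Fin.zero)) a b c = c , a , b

SatNC : ∀ {n} → Order n → Fin 3 × End → Fin n → Fin n → Fin n → Set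
SatNC v (i , top) a b c with pick i a b c
... | t , u , w = ¬ (Prefers v t u × Prefers v t w)
SatNC v (i , bottom) a b c with pick i a b c
... | t , u , w = ¬ (Prefers v u t × Prefers v w t)

-- an assignment of a peak-pit never condition to every triple
-- (values on non-increasing triples are irrelevant)
NCAssignment : ℕ → Set
NCAssignment n = Fin n → Fin n → Fin n → Fin 3 × End

Satisfies : ∀ {n} → NCAssignment n → Order n → Set
Satisfies {n} N v = (a b c : Fin n) → a <ᶠ b → b <ᶠ c → SatNC v (N a b c) a b c

IsPeakPit : (n : ℕ) → List (Order n) → Set
IsPeakPit n D =
  IsCondorcet n D ×
  Σ (NCAssignment n) λ N →
    (v : Order n) → IsLinOrder v → ((v ∈ D → Satisfies N v) × (Satisfies N v → v ∈ D))

-- which function e is meant: f (all Condorcet domains) or h (peak-pit ones)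
data Which : Set where
  fCase hCase : Which

Class : Which → (n : ℕ) → List (Order n) → Set
Class fCase = IsCondorcet
Class hCase = IsPeakPit

-- m is the maximum size of a domain in the class on n alternatives, i.e. m = e(n)
IsMaxSize : (Which) → ℕ → ℕ → Set
IsMaxSize w n m =
  (Σ (List (Order n)) λ D → Class w n D × length D ≡ m) ×
  ((D : List (Order n)) → Class w n D → length D ≤ m)

module Submission where

open import Defs
open import Data.Bool using (true; false)
import Data.Bool.Properties as Bool
open import Data.Empty using (⊥-elim)
open import Data.Fin using (Fin; _↑ˡ_; _↑ʳ_; splitAt; toℕ) renaming (_<_ to _<ᶠ_)
open import Data.Fin.Patterns using (0F; 1F; 2F)
open import Data.Fin.Properties using (_≟_)
import Data.Fin.Properties as Fin
open import Data.List using (List; []; _∷_; _++_; map; length; allFin; cartesianProductWith; filter; last; head)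
open import Data.List.Properties using (length-++; length-map; length-++-sucʳ; length-tabulate)
open import Data.List.Membership.Propositional using (_∈_; _∉_)
open import Data.List.Membership.Propositional.Properties
  using ( ∈-∃++; ∈-++⁻; ∈-++⁺ˡ; ∈-++⁺ʳ; ∈-allFin; ∈-filter⁺; ∈-filter⁻; ∈-map⁺; ∈-map⁻; ∈-length
        ; ∈-cartesianProductWith⁺; ∈-cartesianProductWith⁻)
open import Data.List.Relation.Binary.Disjoint.Propositional using (Disjoint)
open import Data.List.Relation.Binary.Permutation.Propositional using (↭-sym; ↭⇒↭ₛ)
import Data.List.Relation.Binary.Permutation.Setoid.Properties as Perm
import Data.List.Relation.Binary.Pointwise as Pointwise
open import Data.List.Relation.Binary.Subset.Propositional using (_⊆_)
open import Data.List.Relation.Ternary.Interleaving.Propositional using (Interleaving; []; consˡ; consʳ)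
import Data.List.Relation.Ternary.Interleaving.Propositional as Interleaving
open import Data.List.Relation.Unary.All using (All; []; _∷_)
import Data.List.Relation.Unary.All as All
open import Data.List.Relation.Unary.AllPairs using ([]; _∷_)
open import Data.List.Relation.Unary.Any using (Any; here; there)
import Data.List.Relation.Unary.Any as Any
open import Data.List.Relation.Unary.Unique.DecPropositional using (unique?)
open import Data.List.Relation.Unary.Unique.Propositional using (Unique)
import Data.List.Relation.Unary.Unique.Propositional.Properties as Unique
open import Data.Maybe using (just)
open import Data.Maybe.Properties using (just-injective)
open import Data.Nat using (ℕ; zero; suc; _+_; _*_; _^_; _≤_; _<_; z≤n; s≤s; NonZero; >-nonZero)
open import Data.Nat.DivMod using (_/_; _%_; m≡m%n+[m/n]*n; m%n<n; m*n/n≡m; /-mono-≤)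
open import Data.Nat.Properties
  using ( _<?_; ≤-refl; ≤-reflexive; ≤-trans; ≤-pred; <-irrefl; <-asym; <-trans; <-≤-trans; ≤-total; ≤∧≢⇒<; ≮⇒≥
        ; n≤1+n; n<1+n; n≮n; m≤m+n; m≤n+m; +-suc; +-comm; +-assoc; +-identityʳ; +-monoʳ-≤; +-monoˡ-≤; +-monoʳ-<
        ; +-cancelˡ-<; *-comm; *-assoc; *-mono-≤; *-monoʳ-≤; *-monoˡ-≤; *-monoʳ-<; *-cancelˡ-≤
        ; ^-distribˡ-+-*; ^-*-assoc; ^-monoˡ-≤; ^-monoʳ-≤; m^n>0; m^n≢0; even≢odd; module ≤-Reasoning)
open import Data.Nat.Tactic.RingSolver using (solve-∀)
open import Data.Product using (Σ; ∃; ∃-syntax; _×_; _,_; proj₁; proj₂)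
open import Data.Sum using (_⊎_; inj₁; inj₂)
open import Data.Vec using (Vec; []; _∷_; toList)
import Data.Vec as Vec
open import Data.Vec.Properties using (length-toList)
import Data.Vec.Properties as Vec
open import Function using (_∘_)
open import Relation.Binary.Definitions using (tri<; tri≈; tri>)
open import Relation.Binary.PropositionalEquality
  using (_≡_; _≢_; refl; sym; trans; cong; cong₂; subst; subst₂; setoid; module ≡-Reasoning)
open import Relation.Nullary using (¬_; yes; no; Dec; ¬?; _×-dec_; _→-dec_; contradiction)

-- A domain is Condorcet iff no three of its orders rank some triple as x y z, y z x and z x y:
-- an odd profile with a majority cycle contains such three voters, and those three voters form a
-- profile with a majority cycle.  Given domains D on k and E on m alternatives, rank the first k
-- alternatives of k + m as d ∈ D and the last m as e ∈ E, either with the whole block of d on top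
-- or with the last alternative of d and the first of e exchanged.  The 2|D||E| orders obtained
-- have no such cycle: inside a block it would be a cycle of D or E, and on a mixed triple one of
-- the three orders would rank an alternative of e above two of d, or one of d below two of e,
-- whereas the exchanged pair is the only inversion between the blocks.  For peak-pit domains the
-- glued orders satisfy the never conditions of D and E inside the blocks, 3N1 on triples with two
-- left alternatives and 1N3 on triples with two right ones, so all solutions of this assignment
-- form a peak-pit domain at least as large.  Iterating, e(jk + r + 1) ≥ (2e(k))^j, which beats
-- (a/b)^n for large n as soon as a^k < 2e(k)b^k.

private
  variable
    n : ℕ
    a b c x y z : Fin n

length-cartesianProductWith : ∀ {A B C : Set} (f : A → B → C) (xs : List A) (ys : List B) →
  length (cartesianProductWith f xs ys) ≡ length xs * length ys
length-cartesianProductWith f []       ys = refl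
length-cartesianProductWith f (x ∷ xs) ys = begin
  length (map (f x) ys ++ cartesianProductWith f xs ys)
    ≡⟨ length-++ (map (f x) ys) ⟩
  length (map (f x) ys) + length (cartesianProductWith f xs ys)
    ≡⟨ cong₂ _+_ (length-map (f x) ys) (length-cartesianProductWith f xs ys) ⟩
  length ys + length xs * length ys
    ∎
  where open ≡-Reasoning

unique-⊆⇒length≤ : ∀ {A : Set} {xs ys : List A} → Unique xs → xs ⊆ ys → length xs ≤ length ys
unique-⊆⇒length≤ {xs = []} _ _ = z≤n
unique-⊆⇒length≤ {xs = x ∷ xs} {ys} (x∉xs ∷ u) xs⊆ys with ∈-∃++ (xs⊆ys (here refl))
... | ys₁ , ys₂ , refl = subst (suc (length xs) ≤_) (sym (length-++-sucʳ ys₁ x ys₂))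
                               (s≤s (unique-⊆⇒length≤ u xs⊆ys₁++ys₂))
  where
  xs⊆ys₁++ys₂ : xs ⊆ ys₁ ++ ys₂
  xs⊆ys₁++ys₂ {y} y∈xs with ∈-++⁻ ys₁ (xs⊆ys (there y∈xs))
  ... | inj₁ y∈ys₁           = ∈-++⁺ˡ y∈ys₁
  ... | inj₂ (here refl)     = ⊥-elim (All.lookup x∉xs y∈xs refl)
  ... | inj₂ (there y∈ys₂)   = ∈-++⁺ʳ ys₁ y∈ys₂

_++ˢ_ : ∀ {A : Set} {k m} → Vec A k → Vec A m → Vec A (k + m)
[]                ++ˢ ys       = ys
(x ∷ [])          ++ˢ []       = x ∷ []
(x ∷ [])          ++ˢ (y ∷ ys) = y ∷ x ∷ ys
(x ∷ xs@(_ ∷ _)) ++ˢ ys       = x ∷ (xs ++ˢ ys)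

module _ {A : Set} where

  interleaving-right : ∀ (ys : List A) → Interleaving [] ys ys
  interleaving-right ys = Interleaving.right (Pointwise.refl refl)

  ++-interleaving : ∀ {k m} (xs : Vec A k) (ys : Vec A m) →
    Interleaving (toList xs) (toList ys) (toList (xs Vec.++ ys))
  ++-interleaving []       ys = interleaving-right (toList ys)
  ++-interleaving (x ∷ xs) ys = consˡ (++-interleaving xs ys)

  ++ˢ-interleaving : ∀ {k m} (xs : Vec A k) (ys : Vec A m) →
    Interleaving (toList xs) (toList ys) (toList (xs ++ˢ ys))
  ++ˢ-interleaving []                ys       = interleaving-right (toList ys)
  ++ˢ-interleaving (x ∷ [])          []       = consˡ []
  ++ˢ-interleaving (x ∷ [])          (y ∷ ys) = consʳ (consˡ (interleaving-right (toList ys)))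
  ++ˢ-interleaving (x ∷ xs@(_ ∷ _)) ys       = consˡ (++ˢ-interleaving xs ys)

  map-injective : ∀ {B : Set} {f : A → B} → (∀ {a b} → f a ≡ f b → a ≡ b) →
    ∀ {l} {xs ys : Vec A l} → Vec.map f xs ≡ Vec.map f ys → xs ≡ ys
  map-injective f-inj {xs = []}     {[]}     _  = refl
  map-injective f-inj {xs = x ∷ xs} {y ∷ ys} eq =
    cong₂ _∷_ (f-inj (Vec.∷-injectiveˡ eq)) (map-injective f-inj (Vec.∷-injectiveʳ eq))

  ++ˢ-injective : ∀ {k m} (xs xs′ : Vec A k) {ys ys′ : Vec A m} → xs ++ˢ ys ≡ xs′ ++ˢ ys′ → xs ≡ xs′ × ys ≡ ys′
  ++ˢ-injective []       []        eq = refl , eq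
  ++ˢ-injective (x ∷ []) (x′ ∷ []) {[]}     {[]}       refl = refl , refl
  ++ˢ-injective (x ∷ []) (x′ ∷ []) {y ∷ ys} {y′ ∷ ys′} refl = refl , refl
  ++ˢ-injective (x ∷ xs@(_ ∷ _)) (x′ ∷ xs′@(_ ∷ _)) eq
    with refl ← Vec.∷-injectiveˡ eq | refl , refl ← ++ˢ-injective xs xs′ (Vec.∷-injectiveʳ eq) = refl , refl

  ++≢++ˢ : ∀ {k m} (xs xs′ : Vec A k) (ys ys′ : Vec A m) → 0 < k → 0 < m →
    Disjoint (toList xs) (toList ys′) → xs Vec.++ ys ≢ xs′ ++ˢ ys′
  ++≢++ˢ (x ∷ []) (x′ ∷ []) (y ∷ ys) (y′ ∷ ys′) _ _ disjoint eq =
    disjoint (here refl , here (Vec.∷-injectiveˡ eq))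
  ++≢++ˢ (x ∷ xs@(_ ∷ _)) (x′ ∷ xs′@(_ ∷ _)) ys ys′ _ 0<m disjoint eq =
    ++≢++ˢ xs xs′ ys ys′ (s≤s z≤n) 0<m (λ (v∈xs , v∈ys′) → disjoint (there v∈xs , v∈ys′)) (Vec.∷-injectiveʳ eq)

-- Preferences of a single voter

prefB-trans : ∀ (l : List (Fin n)) → prefB l x y ≡ true → prefB l y z ≡ true → prefB l x z ≡ true
prefB-trans [] () _
prefB-trans {x = x} {y} {z} (w ∷ l) p q with w ≟ x | w ≟ y | w ≟ z
... | yes _ | _     | _     = refl
... | no _  | yes _ | _     with () ← p
... | no _  | no _  | yes _ with () ← q
... | no _  | no _  | no _  = prefB-trans l p q

prefB-asym : ∀ (l : List (Fin n)) → x ≢ y → prefB l x y ≡ true → prefB l y x ≡ false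
prefB-asym [] _ ()
prefB-asym {x = x} {y} (w ∷ l) x≢y p with w ≟ y | w ≟ x
... | yes refl | yes refl = ⊥-elim (x≢y refl)
... | yes _    | no _     with () ← p
... | no _     | yes _    = refl
... | no _     | no _     = prefB-asym l x≢y p

prefB-total : ∀ {l : List (Fin n)} → x ∈ l → x ≢ y → prefB l x y ≡ true ⊎ prefB l y x ≡ true
prefB-total {x = x} {y} {w ∷ l} x∈l x≢y with w ≟ x | w ≟ y
... | yes _ | _     = inj₁ refl
... | no _  | yes _ = inj₂ refl
prefB-total (here refl)  _   | no w≢x | no _ = ⊥-elim (w≢x refl)
prefB-total (there x∈l) x≢y | no _   | no _ = prefB-total x∈l x≢y

prefB-map : ∀ {k} (f : Fin k → Fin n) → (∀ {a b} → f a ≡ f b → a ≡ b) →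
  ∀ (l : List (Fin k)) a b → prefB (map f l) (f a) (f b) ≡ prefB l a b
prefB-map f f-inj [] a b = refl
prefB-map f f-inj (c ∷ l) a b with f c ≟ f a | c ≟ a | f c ≟ f b | c ≟ b
... | yes _   | yes _   | _       | _       = refl
... | yes fca | no c≢a  | _       | _       = ⊥-elim (c≢a (f-inj fca))
... | no fc≢a | yes refl | _      | _       = ⊥-elim (fc≢a refl)
... | no _    | no _    | yes _   | yes _   = refl
... | no _    | no _    | yes fcb | no c≢b  = ⊥-elim (c≢b (f-inj fcb))
... | no _    | no _    | no fc≢b | yes refl = ⊥-elim (fc≢b refl)
... | no _    | no _    | no _    | no _    = prefB-map f f-inj l a b

prefB-interleavingˡ : ∀ {l r s : List (Fin n)} → Interleaving l r s → x ∉ r → y ∉ r →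
  prefB s x y ≡ prefB l x y
prefB-interleavingˡ [] _ _ = refl
prefB-interleavingˡ {x = x} {y} {s = w ∷ _} (consˡ i) x∉r y∉r with w ≟ x | w ≟ y
... | yes _ | _     = refl
... | no _  | yes _ = refl
... | no _  | no _  = prefB-interleavingˡ i x∉r y∉r
prefB-interleavingˡ {x = x} {y} {s = w ∷ _} (consʳ i) x∉r y∉r with w ≟ x | w ≟ y
... | yes refl | _        = ⊥-elim (x∉r (here refl))
... | no _     | yes refl = ⊥-elim (y∉r (here refl))
... | no _     | no _     = prefB-interleavingˡ i (x∉r ∘ there) (y∉r ∘ there)

prefB-interleavingʳ : ∀ {l r s : List (Fin n)} → Interleaving l r s → x ∉ l → y ∉ l →
  prefB s x y ≡ prefB r x y
prefB-interleavingʳ i = prefB-interleavingˡ (Interleaving.swap i)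

∈-linearOrder : ∀ {v : Order n} → IsLinOrder v → ∀ x → x ∈ toList v
∈-linearOrder {n} {v} lin x with Any.any? (x ≟_) (toList v)
... | yes x∈v = x∈v
... | no x∉v  = ⊥-elim (n≮n n (subst₂ _≤_ (cong suc (length-toList v)) (length-tabulate {n = n} (λ i → i)) x∷v-fits))
  where
  x∷v-fits : length (x ∷ toList v) ≤ length (allFin n)
  x∷v-fits = unique-⊆⇒length≤ (All.tabulate (λ { y∈v refl → x∉v y∈v }) ∷ lin) (λ {y} _ → ∈-allFin y)

++-noCrossing : ∀ {k m} (xs : Vec (Fin n) k) (ys : Vec (Fin n) m) → x ∈ toList xs → y ∉ toList xs →
  prefB (toList (xs Vec.++ ys)) y x ≡ false
++-noCrossing {x = x} {y} (w ∷ xs) ys x∈xs y∉xs with w ≟ y | w ≟ x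
... | yes refl | _     = ⊥-elim (y∉xs (here refl))
... | no _     | yes _ = refl
++-noCrossing (w ∷ xs) ys (here refl)  y∉xs | no _ | no w≢x = ⊥-elim (w≢x refl)
++-noCrossing (w ∷ xs) ys (there x∈xs) y∉xs | no _ | no _   = ++-noCrossing xs ys x∈xs (y∉xs ∘ there)

++ˢ-crossing : ∀ {k m} (xs : Vec (Fin n) k) (ys : Vec (Fin n) m) → x ∈ toList xs → y ∉ toList xs →
  prefB (toList (xs ++ˢ ys)) y x ≡ true → last (toList xs) ≡ just x × head (toList ys) ≡ just y
++ˢ-crossing {x = x} {y} (w ∷ []) [] (here refl) y∉xs yx with w ≟ y | w ≟ x
... | yes refl | _     = ⊥-elim (y∉xs (here refl))
... | no _     | yes _ with () ← yx
... | no _     | no w≢x = ⊥-elim (w≢x refl)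
++ˢ-crossing {x = x} {y} (w ∷ []) (v ∷ ys) (here refl) y∉xs yx with v ≟ y | v ≟ w
... | yes refl | _     = refl , refl
... | no _     | yes _ with () ← yx
... | no _     | no _  with w ≟ y | w ≟ w
...   | yes refl | _       = ⊥-elim (y∉xs (here refl))
...   | no _     | yes _   with () ← yx
...   | no _     | no w≢w  = ⊥-elim (w≢w refl)
++ˢ-crossing {x = x} {y} (w ∷ xs@(_ ∷ _)) ys x∈xs y∉xs yx with w ≟ y | w ≟ x
... | yes refl | _     = ⊥-elim (y∉xs (here refl))
... | no _     | yes _ with () ← yx
++ˢ-crossing (w ∷ xs@(_ ∷ _)) ys (here refl)  y∉xs yx | no _ | no w≢x = ⊥-elim (w≢x refl)
++ˢ-crossing (w ∷ xs@(_ ∷ _)) ys (there x∈xs) y∉xs yx | no _ | no _   =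
  ++ˢ-crossing xs ys x∈xs (y∉xs ∘ there) yx

-- Condorcet cycles

record Cycle (D : List (Order n)) (x y z : Fin n) : Set where
  field
    x≢y : x ≢ y
    y≢z : y ≢ z
    z≢x : z ≢ x
    u v w : Order n
    u∈D : u ∈ D
    v∈D : v ∈ D
    w∈D : w ∈ D
    u-xy : Prefers u x y
    u-yz : Prefers u y z
    v-yz : Prefers v y z
    v-zx : Prefers v z x
    w-zx : Prefers w z x
    w-xy : Prefers w x y

CycleFree : List (Order n) → Set
CycleFree {n} D = ∀ {x y z : Fin n} → ¬ Cycle D x y z

module _ {D : List (Order n)} where

  rotate : Cycle D x y z → Cycle D y z x
  rotate c = record
    { x≢y = y≢z ; y≢z = z≢x ; z≢x = x≢y
    ; u = v ; v = w ; w = u ; u∈D = v∈D ; v∈D = w∈D ; w∈D = u∈D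
    ; u-xy = v-yz ; u-yz = v-zx ; v-yz = w-zx ; v-zx = w-xy ; w-zx = u-xy ; w-xy = u-yz }
    where open Cycle c

  cycle-top : Cycle D x y z → ∃[ t ] t ∈ D × Prefers t x y × Prefers t x z
  cycle-top c = u , u∈D , u-xy , prefB-trans (toList u) u-xy u-yz
    where open Cycle c

  cycle-bottom : Cycle D x y z → ∃[ t ] t ∈ D × Prefers t y x × Prefers t z x
  cycle-bottom c = v , v∈D , prefB-trans (toList v) v-yz v-zx , v-zx
    where open Cycle c

record Restricts {k} (f : Fin k → Fin n) (σ : Order n) (d : Order k) : Set where
  constructor restricts
  field prefB-restricts : ∀ a b → prefB (toList σ) (f a) (f b) ≡ prefB (toList d) a b

restrict-prefers : ∀ {k} {f : Fin k → Fin n} {σ d} {a b} →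
  Restricts f σ d → Prefers σ (f a) (f b) → Prefers d a b
restrict-prefers {a = a} {b} (restricts r) σ-ab = trans (sym (r a b)) σ-ab

cycle-restrict : ∀ {k} {S : List (Order n)} {D : List (Order k)} {a b c : Fin k} (f : Fin k → Fin n) →
  (∀ {σ} → σ ∈ S → ∃[ d ] d ∈ D × Restricts f σ d) → Cycle S (f a) (f b) (f c) → Cycle D a b c
cycle-restrict f restriction cyc
  with d₁ , d₁∈D , r₁ ← restriction (Cycle.u∈D cyc)
     | d₂ , d₂∈D , r₂ ← restriction (Cycle.v∈D cyc)
     | d₃ , d₃∈D , r₃ ← restriction (Cycle.w∈D cyc) = record
  { x≢y = x≢y ∘ cong f ; y≢z = y≢z ∘ cong f ; z≢x = z≢x ∘ cong f
  ; u = d₁ ; v = d₂ ; w = d₃ ; u∈D = d₁∈D ; v∈D = d₂∈D ; w∈D = d₃∈D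
  ; u-xy = restrict-prefers r₁ u-xy ; u-yz = restrict-prefers r₁ u-yz
  ; v-yz = restrict-prefers r₂ v-yz ; v-zx = restrict-prefers r₂ v-zx
  ; w-zx = restrict-prefers r₃ w-zx ; w-xy = restrict-prefers r₃ w-xy }
  where open Cycle cyc

satNC-restrict : ∀ {k} {f : Fin k → Fin n} {σ d} {a b c : Fin k} → Restricts f σ d →
  ∀ nc → SatNC d nc a b c → SatNC σ nc (f a) (f b) (f c)
satNC-restrict r (0F , top)    sat (p , q) = sat (restrict-prefers r p , restrict-prefers r q)
satNC-restrict r (1F , top)    sat (p , q) = sat (restrict-prefers r p , restrict-prefers r q)
satNC-restrict r (2F , top)    sat (p , q) = sat (restrict-prefers r p , restrict-prefers r q)
satNC-restrict r (0F , bottom) sat (p , q) = sat (restrict-prefers r p , restrict-prefers r q)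
satNC-restrict r (1F , bottom) sat (p , q) = sat (restrict-prefers r p , restrict-prefers r q)
satNC-restrict r (2F , bottom) sat (p , q) = sat (restrict-prefers r p , restrict-prefers r q)

condorcet⇒cycleFree : ∀ {D : List (Order n)} → IsCondorcet n D → CycleFree D
condorcet⇒cycleFree (_ , transitive) {x} {y} {z} c =
  <-asym (transitive P (u∈D ∷ v∈D ∷ w∈D ∷ []) (1 , refl) x y z x-beats-y y-beats-z) z-beats-x
  where
  open Cycle c
  P = u ∷ v ∷ w ∷ []
  v-yx : Prefers v y x
  v-yx = prefB-trans (toList v) v-yz v-zx
  w-zy : Prefers w z y
  w-zy = prefB-trans (toList w) w-zx w-xy
  u-xz : Prefers u x z
  u-xz = prefB-trans (toList u) u-xy u-yz
  x-beats-y : Maj P x y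
  x-beats-y rewrite u-xy | prefB-asym (toList u) x≢y u-xy | v-yx | prefB-asym (toList v) (x≢y ∘ sym) v-yx
                  | w-xy | prefB-asym (toList w) x≢y w-xy = s≤s (s≤s z≤n)
  y-beats-z : Maj P y z
  y-beats-z rewrite u-yz | prefB-asym (toList u) y≢z u-yz | v-yz | prefB-asym (toList v) y≢z v-yz
                  | w-zy | prefB-asym (toList w) (y≢z ∘ sym) w-zy = s≤s (s≤s z≤n)
  z-beats-x : Maj P z x
  z-beats-x rewrite u-xz | prefB-asym (toList u) (z≢x ∘ sym) u-xz | v-zx | prefB-asym (toList v) z≢x v-zx
                  | w-zx | prefB-asym (toList w) z≢x w-zx = s≤s (s≤s z≤n)

countPref-complement : ∀ {P : List (Order n)} → All IsLinOrder P → x ≢ y →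
  countPref P x y + countPref P y x ≡ length P
countPref-complement [] _ = refl
countPref-complement {x = x} {y} {v ∷ P} (lin ∷ lins) x≢y with prefB-total (∈-linearOrder lin x) x≢y
... | inj₁ xy rewrite xy | prefB-asym (toList v) x≢y xy = cong suc (countPref-complement lins x≢y)
... | inj₂ yx rewrite yx | prefB-asym (toList v) (x≢y ∘ sym) yx =
  trans (+-suc (countPref P x y) (countPref P y x)) (cong suc (countPref-complement lins x≢y))

majority-complete : ∀ {P : List (Order n)} → All IsLinOrder P → Odd (length P) → x ≢ y →
  ¬ Maj P x y → Maj P y x
majority-complete {x = x} {y} {P} lins (j , odd) x≢y ¬x-beats-y = ≤∧≢⇒< (≮⇒≥ ¬x-beats-y) no-tie
  where
  no-tie : countPref P x y ≢ countPref P y x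
  no-tie tie = even≢odd (countPref P x y) j (begin
    2 * countPref P x y                   ≡⟨ cong (countPref P x y +_) (+-identityʳ _) ⟩
    countPref P x y + countPref P x y     ≡⟨ cong (countPref P x y +_) tie ⟩
    countPref P x y + countPref P y x     ≡⟨ countPref-complement lins x≢y ⟩
    length P                              ≡⟨ odd ⟩
    suc (2 * j)                           ∎)
    where open ≡-Reasoning

majority⇒more-than-half : ∀ {P : List (Order n)} → All IsLinOrder P → Maj P x y →
  length P < countPref P x y + countPref P x y
majority⇒more-than-half {x = x} {y} {P} lins x-beats-y =
  subst (_< countPref P x y + countPref P x y) (countPref-complement lins x≢y)
        (+-monoʳ-< (countPref P x y) x-beats-y)
  where
  x≢y : x ≢ y
  x≢y refl = <-irrefl refl x-beats-y

common-voter : ∀ (P : List (Order n)) → length P < countPref P x y + countPref P y z →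
  Any (λ v → Prefers v x y × Prefers v y z) P
common-voter [] ()
common-voter {x = x} {y} {z} (v ∷ P) more with prefB (toList v) x y in xy | prefB (toList v) y z in yz
... | true  | true  = here (xy , yz)
... | true  | false = there (common-voter P (≤-pred more))
... | false | true  =
  there (common-voter P (≤-pred (subst (suc (length P) <_) (+-suc (countPref P x y) (countPref P y z)) more)))
... | false | false = there (common-voter P (<-trans (n<1+n _) more))

m<n+n⇒m<o+o⇒m<n+o : ∀ {m} n o → m < n + n → m < o + o → m < n + o
m<n+n⇒m<o+o⇒m<n+o n o m<n+n m<o+o with ≤-total n o
... | inj₁ n≤o = <-≤-trans m<n+n (+-monoʳ-≤ n n≤o)
... | inj₂ o≤n = <-≤-trans m<o+o (+-monoˡ-≤ o o≤n)

majorities-meet : ∀ {P : List (Order n)} → All IsLinOrder P → Maj P x y → Maj P y z →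
  Any (λ v → Prefers v x y × Prefers v y z) P
majorities-meet {x = x} {y} {z} {P} lins x-beats-y y-beats-z =
  common-voter P (m<n+n⇒m<o+o⇒m<n+o (countPref P x y) (countPref P y z)
    (majority⇒more-than-half {x = x} {y} lins x-beats-y) (majority⇒more-than-half {x = y} {z} lins y-beats-z))

majority-cycle⇒cycle : ∀ {D P : List (Order n)} → All (_∈ D) P → All IsLinOrder P →
  Maj P x y → Maj P y z → Maj P z x → Cycle D x y z
majority-cycle⇒cycle {x = x} {y} {z} P⊆D lins x-beats-y y-beats-z z-beats-x
  with u∈D , u-xy , u-yz ← All.lookupAny P⊆D (majorities-meet {x = x} {y} {z} lins x-beats-y y-beats-z)
     | v∈D , v-yz , v-zx ← All.lookupAny P⊆D (majorities-meet {x = y} {z} {x} lins y-beats-z z-beats-x)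
     | w∈D , w-zx , w-xy ← All.lookupAny P⊆D (majorities-meet {x = z} {x} {y} lins z-beats-x x-beats-y) = record
  { x≢y = λ { refl → <-irrefl refl x-beats-y }
  ; y≢z = λ { refl → <-irrefl refl y-beats-z }
  ; z≢x = λ { refl → <-irrefl refl z-beats-x }
  ; u = _ ; v = _ ; w = _ ; u∈D = u∈D ; v∈D = v∈D ; w∈D = w∈D
  ; u-xy = u-xy ; u-yz = u-yz ; v-yz = v-yz ; v-zx = v-zx ; w-zx = w-zx ; w-xy = w-xy }

cycleFree⇒condorcet : ∀ {D : List (Order n)} → IsDomain n D → CycleFree D → IsCondorcet n D
cycleFree⇒condorcet {D = D} dom@(lins , _) cycleFree = dom , transitive
  where
  transitive : ∀ P → All (_∈ D) P → Odd (length P) → MajTransitive P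
  transitive P P⊆D odd x y z x-beats-y y-beats-z with countPref P z x <? countPref P x z
  ... | yes x-beats-z = x-beats-z
  ... | no ¬x-beats-z = ⊥-elim (cycleFree (majority-cycle⇒cycle P⊆D linsP x-beats-y y-beats-z
                                             (majority-complete linsP odd x≢z ¬x-beats-z)))
    where
    linsP : All IsLinOrder P
    linsP = All.map (All.lookup lins) P⊆D
    x≢z : x ≢ z
    x≢z refl = <-asym x-beats-y y-beats-z

-- Never conditions

CycleOn : List (Order n) → Fin n → Fin n → Fin n → Set
CycleOn D a b c = Cycle D a b c ⊎ Cycle D a c b

module _ {D : List (Order n)} where

  cycleOn-second : CycleOn D a b c → CycleOn D b a c
  cycleOn-second (inj₁ cyc) = inj₂ (rotate cyc)
  cycleOn-second (inj₂ cyc) = inj₁ (rotate (rotate cyc))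

  cycleOn-third : CycleOn D a b c → CycleOn D c a b
  cycleOn-third (inj₁ cyc) = inj₁ (rotate (rotate cyc))
  cycleOn-third (inj₂ cyc) = inj₂ (rotate cyc)

  cycleOn-top : CycleOn D a b c → ∃[ t ] t ∈ D × Prefers t a b × Prefers t a c
  cycleOn-top (inj₁ cyc) = cycle-top cyc
  cycleOn-top (inj₂ cyc) with t , t∈D , ac , ab ← cycle-top cyc = t , t∈D , ab , ac

  cycleOn-bottom : CycleOn D a b c → ∃[ t ] t ∈ D × Prefers t b a × Prefers t c a
  cycleOn-bottom (inj₁ cyc) = cycle-bottom cyc
  cycleOn-bottom (inj₂ cyc) with t , t∈D , ca , ba ← cycle-bottom cyc = t , t∈D , ba , ca

  refuted : ∀ {P : Order n → Set} → ∃[ t ] t ∈ D × P t → ∃[ t ] t ∈ D × ¬ ¬ P t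
  refuted (t , t∈D , p) = t , t∈D , λ ¬p → ¬p p

  cycleOn-violates : ∀ nc → CycleOn D a b c → ∃[ t ] t ∈ D × ¬ SatNC t nc a b c
  cycleOn-violates (0F , top)    = refuted ∘ cycleOn-top
  cycleOn-violates (1F , top)    = refuted ∘ cycleOn-top ∘ cycleOn-second
  cycleOn-violates (2F , top)    = refuted ∘ cycleOn-top ∘ cycleOn-third
  cycleOn-violates (0F , bottom) = refuted ∘ cycleOn-bottom
  cycleOn-violates (1F , bottom) = refuted ∘ cycleOn-bottom ∘ cycleOn-second
  cycleOn-violates (2F , bottom) = refuted ∘ cycleOn-bottom ∘ cycleOn-third

  sortCycleFromMin : Cycle D x y z → x <ᶠ y → x <ᶠ z → ∃[ a ] ∃[ b ] ∃[ c ] a <ᶠ b × b <ᶠ c × CycleOn D a b c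
  sortCycleFromMin {y = y} {z} cyc x<y x<z with Fin.<-cmp y z
  ... | tri< y<z _ _ = _ , _ , _ , x<y , y<z , inj₁ cyc
  ... | tri≈ _ y≡z _ = ⊥-elim (Cycle.y≢z cyc y≡z)
  ... | tri> _ _ z<y = _ , _ , _ , x<z , z<y , inj₂ cyc

  sortCycle : Cycle D x y z → ∃[ a ] ∃[ b ] ∃[ c ] a <ᶠ b × b <ᶠ c × CycleOn D a b c
  sortCycle {x = x} {y} {z} cyc with Fin.<-cmp x y | Fin.<-cmp x z | Fin.<-cmp y z
  ... | tri≈ _ x≡y _ | _ | _ = ⊥-elim (Cycle.x≢y cyc x≡y)
  ... | _ | tri≈ _ x≡z _ | _ = ⊥-elim (Cycle.z≢x cyc (sym x≡z))
  ... | _ | _ | tri≈ _ y≡z _ = ⊥-elim (Cycle.y≢z cyc y≡z)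
  ... | tri< x<y _ _ | tri< x<z _ _ | _ = sortCycleFromMin cyc x<y x<z
  ... | tri< x<y _ _ | tri> _ _ z<x | _ = sortCycleFromMin (rotate (rotate cyc)) z<x (Fin.<-trans z<x x<y)
  ... | tri> _ _ y<x | _ | tri< y<z _ _ = sortCycleFromMin (rotate cyc) y<z y<x
  ... | tri> _ _ y<x | _ | tri> _ _ z<y = sortCycleFromMin (rotate (rotate cyc)) (Fin.<-trans z<y y<x) z<y

satisfies⇒cycleFree : ∀ {D : List (Order n)} (N : NCAssignment n) →
  (∀ {v} → v ∈ D → Satisfies N v) → CycleFree D
satisfies⇒cycleFree N sat cyc with a , b , c , a<b , b<c , cycOn ← sortCycle cyc
  with t , t∈D , ¬sat ← cycleOn-violates (N a b c) cycOn = ¬sat (sat t∈D a b c a<b b<c)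

vectors : ∀ n l → List (Vec (Fin n) l)
vectors n zero    = Vec.[] ∷ []
vectors n (suc l) = cartesianProductWith Vec._∷_ (allFin n) (vectors n l)

∈-vectors : ∀ {l} (v : Vec (Fin n) l) → v ∈ vectors n l
∈-vectors Vec.[]       = here refl
∈-vectors (x Vec.∷ v) = ∈-cartesianProductWith⁺ Vec._∷_ (∈-allFin x) (∈-vectors v)

vectors-unique : ∀ n l → Unique (vectors n l)
vectors-unique n zero    = [] ∷ []
vectors-unique n (suc l) =
  Unique.cartesianProductWith⁺ Vec._∷_ Vec.∷-injective (Unique.allFin⁺ n) (vectors-unique n l)

prefers? : ∀ (v : Order n) a b → Dec (Prefers v a b)
prefers? v a b = prefB (toList v) a b Bool.≟ true

satNC? : ∀ (v : Order n) nc a b c → Dec (SatNC v nc a b c)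
satNC? v (i , top) a b c with pick i a b c
... | t , u , w = ¬? (prefers? v t u ×-dec prefers? v t w)
satNC? v (i , bottom) a b c with pick i a b c
... | t , u , w = ¬? (prefers? v u t ×-dec prefers? v w t)

satisfies? : ∀ (N : NCAssignment n) v → Dec (Satisfies N v)
satisfies? N v = Fin.all? λ a → Fin.all? λ b → Fin.all? λ c →
  (a Fin.<? b) →-dec (b Fin.<? c) →-dec satNC? v (N a b c) a b c

module _ (N : NCAssignment n) where

  IsSolution : Order n → Set
  IsSolution v = IsLinOrder v × Satisfies N v

  isSolution? : ∀ v → Dec (IsSolution v)
  isSolution? v = unique? Fin._≟_ (toList v) ×-dec satisfies? N v

  solutions : List (Order n)
  solutions = filter isSolution? (vectors n n)

  ∈-solutions⁺ : ∀ {v} → IsSolution v → v ∈ solutions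
  ∈-solutions⁺ = ∈-filter⁺ isSolution? (∈-vectors _)

  ∈-solutions⁻ : ∀ {v} → v ∈ solutions → IsSolution v
  ∈-solutions⁻ v∈sol = proj₂ (∈-filter⁻ isSolution? {xs = vectors n n} v∈sol)

  solutions-isPeakPit : IsPeakPit n solutions
  solutions-isPeakPit =
    cycleFree⇒condorcet domain (satisfies⇒cycleFree N (proj₂ ∘ ∈-solutions⁻)) ,
    N , λ v lin → proj₂ ∘ ∈-solutions⁻ , ∈-solutions⁺ ∘ (lin ,_)
    where
    domain : IsDomain n solutions
    domain = All.tabulate (proj₁ ∘ ∈-solutions⁻) , Unique.filter⁺ isSolution? (vectors-unique n n)

-- Gluing two domains

module Glue (k m : ℕ) where

  inl : Fin k → Fin (k + m)
  inl a = a ↑ˡ m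

  inr : Fin m → Fin (k + m)
  inr b = k ↑ʳ b

  inl-injective : ∀ {a a′} → inl a ≡ inl a′ → a ≡ a′
  inl-injective = Fin.↑ˡ-injective m _ _

  inr-injective : ∀ {b b′} → inr b ≡ inr b′ → b ≡ b′
  inr-injective = Fin.↑ʳ-injective k _ _

  inl≢inr : ∀ {a b} → inl a ≢ inr b
  inl≢inr {a} {b} eq
    with () ← trans (sym (Fin.splitAt-↑ˡ k a m)) (trans (cong (splitAt k) eq) (Fin.splitAt-↑ʳ k m b))

  inl-<⁻ : ∀ {a a′} → inl a <ᶠ inl a′ → a <ᶠ a′
  inl-<⁻ {a} {a′} = subst₂ _<_ (Fin.toℕ-↑ˡ a m) (Fin.toℕ-↑ˡ a′ m)

  inr-<⁻ : ∀ {b b′} → inr b <ᶠ inr b′ → b <ᶠ b′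
  inr-<⁻ {b} {b′} lt = +-cancelˡ-< k _ _ (subst₂ _<_ (Fin.toℕ-↑ʳ k b) (Fin.toℕ-↑ʳ k b′) lt)

  inr≮inl : ∀ {a b} → ¬ inr b <ᶠ inl a
  inr≮inl {a} {b} lt = n≮n k (begin-strict
    k              ≤⟨ m≤m+n k (toℕ b) ⟩
    k + toℕ b      ≡⟨ Fin.toℕ-↑ʳ k b ⟨
    toℕ (inr b)    <⟨ lt ⟩
    toℕ (inl a)    ≡⟨ Fin.toℕ-↑ˡ a m ⟩
    toℕ a          <⟨ Fin.toℕ<n a ⟩
    k              ∎)
    where open ≤-Reasoning

  data Block : Fin (k + m) → Set where
    left  : ∀ a → Block (inl a)
    right : ∀ b → Block (inr b)

  block : ∀ i → Block i
  block i with splitAt k i in eq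
  ... | inj₁ a = subst Block (Fin.splitAt⁻¹-↑ˡ eq) (left a)
  ... | inj₂ b = subst Block (Fin.splitAt⁻¹-↑ʳ eq) (right b)

  lefts : Order k → Vec (Fin (k + m)) k
  lefts = Vec.map inl

  rights : Order m → Vec (Fin (k + m)) m
  rights = Vec.map inr

  glue glueSwapped : Order k → Order m → Order (k + m)
  glue        d e = lefts d Vec.++ rights e
  glueSwapped d e = lefts d ++ˢ rights e

  inl∈lefts : ∀ {d} → IsLinOrder d → ∀ a → inl a ∈ toList (lefts d)
  inl∈lefts {d} lin a = subst (inl a ∈_) (sym (Vec.toList-map inl d)) (∈-map⁺ inl (∈-linearOrder lin a))

  inr∉lefts : ∀ d b → inr b ∉ toList (lefts d)
  inr∉lefts d b inr∈lefts
    with _ , _ , eq ← ∈-map⁻ inl (subst (_ ∈_) (Vec.toList-map inl d) inr∈lefts) = inl≢inr (sym eq)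

  inl∉rights : ∀ e a → inl a ∉ toList (rights e)
  inl∉rights e a inl∈rights
    with _ , _ , eq ← ∈-map⁻ inr (subst (_ ∈_) (Vec.toList-map inr e) inl∈rights) = inl≢inr eq

  lefts-rights-disjoint : ∀ d e → Disjoint (toList (lefts d)) (toList (rights e))
  lefts-rights-disjoint d e (i∈lefts , i∈rights)
    with a , _ , refl ← ∈-map⁻ inl (subst (_ ∈_) (Vec.toList-map inl d) i∈lefts) = inl∉rights e a i∈rights

  unique-lefts : ∀ {d} → IsLinOrder d → Unique (toList (lefts d))
  unique-lefts {d} lin = subst Unique (sym (Vec.toList-map inl d)) (Unique.map⁺ inl-injective lin)

  unique-rights : ∀ {e} → IsLinOrder e → Unique (toList (rights e))
  unique-rights {e} lin = subst Unique (sym (Vec.toList-map inr e)) (Unique.map⁺ inr-injective lin)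

  prefB-lefts : ∀ d a a′ → prefB (toList (lefts d)) (inl a) (inl a′) ≡ prefB (toList d) a a′
  prefB-lefts d a a′ = trans (cong (λ l → prefB l (inl a) (inl a′)) (Vec.toList-map inl d))
                             (prefB-map inl inl-injective (toList d) a a′)

  prefB-rights : ∀ e b b′ → prefB (toList (rights e)) (inr b) (inr b′) ≡ prefB (toList e) b b′
  prefB-rights e b b′ = trans (cong (λ l → prefB l (inr b) (inr b′)) (Vec.toList-map inr e))
                              (prefB-map inr inr-injective (toList e) b b′)

  record Glued (σ : Order (k + m)) (d : Order k) (e : Order m) : Set where
    field
      linear     : IsLinOrder σ
      restrictsˡ : Restricts inl σ d
      restrictsʳ : Restricts inr σ e
      crossing   : ∀ {a b} → Prefers σ (inr b) (inl a) →
                   last (toList (lefts d)) ≡ just (inl a) × head (toList (rights e)) ≡ just (inr b)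

    above-unique : ∀ {a a′ b} → Prefers σ (inr b) (inl a) → Prefers σ (inr b) (inl a′) → a ≡ a′
    above-unique ba ba′ =
      inl-injective (just-injective (trans (sym (proj₁ (crossing ba))) (proj₁ (crossing ba′))))

    below-unique : ∀ {a b b′} → Prefers σ (inr b) (inl a) → Prefers σ (inr b′) (inl a) → b ≡ b′
    below-unique ba b′a =
      inr-injective (just-injective (trans (sym (proj₂ (crossing ba))) (proj₂ (crossing b′a))))

  interleaving⇒glued : ∀ {σ d e} → IsLinOrder d → IsLinOrder e →
    Interleaving (toList (lefts d)) (toList (rights e)) (toList σ) →
    (∀ {a b} → Prefers σ (inr b) (inl a) →
               last (toList (lefts d)) ≡ just (inl a) × head (toList (rights e)) ≡ just (inr b)) →
    Glued σ d e
  interleaving⇒glued {σ} {d} {e} lin-d lin-e i crossing = record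
    { linear     = Perm.Unique-resp-↭ (setoid _) (↭⇒↭ₛ (↭-sym (Interleaving.toPermutation i)))
                     (Unique.++⁺ (unique-lefts lin-d) (unique-rights lin-e) (lefts-rights-disjoint d e))
    ; restrictsˡ = restricts λ a a′ →
        trans (prefB-interleavingˡ i (inl∉rights e a) (inl∉rights e a′)) (prefB-lefts d a a′)
    ; restrictsʳ = restricts λ b b′ →
        trans (prefB-interleavingʳ i (inr∉lefts d b) (inr∉lefts d b′)) (prefB-rights e b b′)
    ; crossing   = crossing
    }

  glue-glued : ∀ {d e} → IsLinOrder d → IsLinOrder e → Glued (glue d e) d e
  glue-glued {d} {e} lin-d lin-e =
    interleaving⇒glued lin-d lin-e (++-interleaving (lefts d) (rights e)) λ {a} {b} ba →
      contradiction (trans (sym (++-noCrossing (lefts d) (rights e) (inl∈lefts lin-d a) (inr∉lefts d b))) ba) λ ()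

  glueSwapped-glued : ∀ {d e} → IsLinOrder d → IsLinOrder e → Glued (glueSwapped d e) d e
  glueSwapped-glued {d} {e} lin-d lin-e =
    interleaving⇒glued lin-d lin-e (++ˢ-interleaving (lefts d) (rights e)) λ {a} {b} →
      ++ˢ-crossing (lefts d) (rights e) (inl∈lefts lin-d a) (inr∉lefts d b)

  GluedFrom : List (Order k) → List (Order m) → Order (k + m) → Set
  GluedFrom D E σ = ∃[ d ] ∃[ e ] d ∈ D × e ∈ E × Glued σ d e

  module _ {D : List (Order k)} {E : List (Order m)} {S : List (Order (k + m))}
           (glued : ∀ {σ} → σ ∈ S → GluedFrom D E σ) where

    restrictionˡ : ∀ {σ} → σ ∈ S → ∃[ d ] d ∈ D × Restricts inl σ d
    restrictionˡ σ∈S with d , _ , d∈D , _ , g ← glued σ∈S = d , d∈D , Glued.restrictsˡ g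

    restrictionʳ : ∀ {σ} → σ ∈ S → ∃[ e ] e ∈ E × Restricts inr σ e
    restrictionʳ σ∈S with _ , e , _ , e∈E , g ← glued σ∈S = e , e∈E , Glued.restrictsʳ g

    no-cycle-right-left-left : ∀ {a a′ b} → ¬ Cycle S (inr b) (inl a) (inl a′)
    no-cycle-right-left-left cyc
      with σ , σ∈S , ba , ba′ ← cycle-top cyc with _ , _ , _ , _ , g ← glued σ∈S =
      Cycle.y≢z cyc (cong inl (Glued.above-unique g ba ba′))

    no-cycle-left-right-right : ∀ {a b b′} → ¬ Cycle S (inl a) (inr b) (inr b′)
    no-cycle-left-right-right cyc
      with σ , σ∈S , ba , b′a ← cycle-bottom cyc with _ , _ , _ , _ , g ← glued σ∈S =
      Cycle.y≢z cyc (cong inr (Glued.below-unique g ba b′a))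

    glued-cycleFree : CycleFree D → CycleFree E → CycleFree S
    glued-cycleFree freeD freeE {x} {y} {z} cyc with block x | block y | block z
    ... | left _  | left _  | left _  = freeD (cycle-restrict inl restrictionˡ cyc)
    ... | right _ | right _ | right _ = freeE (cycle-restrict inr restrictionʳ cyc)
    ... | right _ | left _  | left _  = no-cycle-right-left-left cyc
    ... | left _  | right _ | left _  = no-cycle-right-left-left (rotate cyc)
    ... | left _  | left _  | right _ = no-cycle-right-left-left (rotate (rotate cyc))
    ... | left _  | right _ | right _ = no-cycle-left-right-right cyc
    ... | right _ | left _  | right _ = no-cycle-left-right-right (rotate cyc)
    ... | right _ | right _ | left _  = no-cycle-left-right-right (rotate (rotate cyc))

  glueAssignment : NCAssignment k → NCAssignment m → NCAssignment (k + m)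
  glueAssignment ND NE x y z with splitAt k x | splitAt k y | splitAt k z
  ... | inj₁ a | inj₁ b | inj₁ c = ND a b c
  ... | inj₂ a | inj₂ b | inj₂ c = NE a b c
  ... | inj₁ _ | inj₁ _ | inj₂ _ = 2F , top
  ... | inj₁ _ | inj₂ _ | inj₂ _ = 0F , bottom
  ... | _      | _      | _      = 0F , top   -- never used: this triple is not increasing

  glued-satisfies : ∀ {ND NE σ d e} → Glued σ d e → Satisfies ND d → Satisfies NE e →
    Satisfies (glueAssignment ND NE) σ
  glued-satisfies {ND} {NE} {σ} g sat-d sat-e x y z x<y y<z = go (block x) (block y) (block z) x<y y<z
    where
    go : ∀ {x y z} → Block x → Block y → Block z → x <ᶠ y → y <ᶠ z → SatNC σ (glueAssignment ND NE x y z) x y z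
    go (left a) (left b) (left c) a<b b<c
      rewrite Fin.splitAt-↑ˡ k a m | Fin.splitAt-↑ˡ k b m | Fin.splitAt-↑ˡ k c m =
      satNC-restrict (Glued.restrictsˡ g) (ND a b c) (sat-d a b c (inl-<⁻ a<b) (inl-<⁻ b<c))
    go (right a) (right b) (right c) a<b b<c
      rewrite Fin.splitAt-↑ʳ k m a | Fin.splitAt-↑ʳ k m b | Fin.splitAt-↑ʳ k m c =
      satNC-restrict (Glued.restrictsʳ g) (NE a b c) (sat-e a b c (inr-<⁻ a<b) (inr-<⁻ b<c))
    go (left a) (left a′) (right b) a<a′ _
      rewrite Fin.splitAt-↑ˡ k a m | Fin.splitAt-↑ˡ k a′ m | Fin.splitAt-↑ʳ k m b =
      λ (ba , ba′) → Fin.<-irrefl (cong inl (Glued.above-unique g ba ba′)) a<a′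
    go (left a) (right b) (right b′) _ b<b′
      rewrite Fin.splitAt-↑ˡ k a m | Fin.splitAt-↑ʳ k m b | Fin.splitAt-↑ʳ k m b′ =
      λ (ba , b′a) → Fin.<-irrefl (cong inr (Glued.below-unique g ba b′a)) b<b′
    go (left _)  (right _) (left _) _   b<c = ⊥-elim (inr≮inl b<c)
    go (right _) (left _)  _        a<b _   = ⊥-elim (inr≮inl a<b)
    go (right _) (right _) (left _) _   b<c = ⊥-elim (inr≮inl b<c)

  glue-injective : ∀ {d d′ e e′} → glue d e ≡ glue d′ e′ → d ≡ d′ × e ≡ e′
  glue-injective {d} {d′} eq with lefts-eq , rights-eq ← Vec.++-injective (lefts d) (lefts d′) eq =
    map-injective inl-injective lefts-eq , map-injective inr-injective rights-eq

  glueSwapped-injective : ∀ {d d′ e e′} → glueSwapped d e ≡ glueSwapped d′ e′ → d ≡ d′ × e ≡ e′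
  glueSwapped-injective {d} {d′} eq with lefts-eq , rights-eq ← ++ˢ-injective (lefts d) (lefts d′) eq =
    map-injective inl-injective lefts-eq , map-injective inr-injective rights-eq

  glue≢glueSwapped : 0 < k → 0 < m → ∀ {d d′ e e′} → glue d e ≢ glueSwapped d′ e′
  glue≢glueSwapped 0<k 0<m {d} {d′} {e} {e′} =
    ++≢++ˢ (lefts d) (lefts d′) (rights e) (rights e′) 0<k 0<m (lefts-rights-disjoint d e′)

  glueDomain : List (Order k) → List (Order m) → List (Order (k + m))
  glueDomain D E = cartesianProductWith glue D E ++ cartesianProductWith glueSwapped D E

  length-glueDomain : ∀ D E → length (glueDomain D E) ≡ 2 * length D * length E
  length-glueDomain D E = begin
    length (glueDomain D E)                    ≡⟨ length-++ (cartesianProductWith glue D E) ⟩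
    length (cartesianProductWith glue D E) + length (cartesianProductWith glueSwapped D E)
      ≡⟨ cong₂ _+_ (length-cartesianProductWith glue D E) (length-cartesianProductWith glueSwapped D E) ⟩
    length D * length E + length D * length E ≡⟨ cong (length D * length E +_) (+-identityʳ _) ⟨
    2 * (length D * length E)                  ≡⟨ *-assoc 2 (length D) (length E) ⟨
    2 * length D * length E                    ∎
    where open ≡-Reasoning

  size-glueDomain : ∀ D E {s t} → s ≤ length D → t ≤ length E → 2 * s * t ≤ length (glueDomain D E)
  size-glueDomain D E s≤D t≤E =
    subst (_ ≤_) (sym (length-glueDomain D E)) (*-mono-≤ (*-monoʳ-≤ 2 s≤D) t≤E)

  glueDomain-unique : 0 < k → 0 < m → ∀ {D E} → Unique D → Unique E → Unique (glueDomain D E)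
  glueDomain-unique 0<k 0<m {D} {E} uD uE = Unique.++⁺
    (Unique.cartesianProductWith⁺ glue glue-injective uD uE)
    (Unique.cartesianProductWith⁺ glueSwapped glueSwapped-injective uD uE)
    λ (σ∈glue , σ∈glueSwapped) →
      let d , e , _ , _ , σ≡glue          = ∈-cartesianProductWith⁻ glue D E σ∈glue
          d′ , e′ , _ , _ , σ≡glueSwapped = ∈-cartesianProductWith⁻ glueSwapped D E σ∈glueSwapped
      in glue≢glueSwapped 0<k 0<m {d} {d′} {e} {e′} (trans (sym σ≡glue) σ≡glueSwapped)

  ∈-glueDomain⁻ : ∀ {D E} → All IsLinOrder D → All IsLinOrder E → ∀ {σ} → σ ∈ glueDomain D E → GluedFrom D E σ
  ∈-glueDomain⁻ {D} {E} lins-D lins-E σ∈S with ∈-++⁻ (cartesianProductWith glue D E) σ∈S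
  ... | inj₁ σ∈glue with d , e , d∈D , e∈E , refl ← ∈-cartesianProductWith⁻ glue D E σ∈glue =
    d , e , d∈D , e∈E , glue-glued (All.lookup lins-D d∈D) (All.lookup lins-E e∈E)
  ... | inj₂ σ∈glueSwapped with d , e , d∈D , e∈E , refl ← ∈-cartesianProductWith⁻ glueSwapped D E σ∈glueSwapped =
    d , e , d∈D , e∈E , glueSwapped-glued (All.lookup lins-D d∈D) (All.lookup lins-E e∈E)

  glueDomain-condorcet : 0 < k → 0 < m → ∀ {D E} → IsCondorcet k D → IsCondorcet m E →
    IsCondorcet (k + m) (glueDomain D E)
  glueDomain-condorcet 0<k 0<m cond-D@((lins-D , unique-D) , _) cond-E@((lins-E , unique-E) , _) =
    cycleFree⇒condorcet
      (All.tabulate linear , glueDomain-unique 0<k 0<m unique-D unique-E)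
      (glued-cycleFree glued (condorcet⇒cycleFree cond-D) (condorcet⇒cycleFree cond-E))
    where
    glued = ∈-glueDomain⁻ lins-D lins-E
    linear : ∀ {σ} → σ ∈ _ → IsLinOrder σ
    linear σ∈S with _ , _ , _ , _ , g ← glued σ∈S = Glued.linear g

  glueDomain⊆solutions : ∀ {D E ND NE} → All IsLinOrder D → All IsLinOrder E →
    (∀ {d} → d ∈ D → Satisfies ND d) → (∀ {e} → e ∈ E → Satisfies NE e) →
    glueDomain D E ⊆ solutions (glueAssignment ND NE)
  glueDomain⊆solutions {ND = ND} {NE} lins-D lins-E sat-D sat-E σ∈S
    with _ , _ , d∈D , e∈E , g ← ∈-glueDomain⁻ lins-D lins-E σ∈S =
    ∈-solutions⁺ (glueAssignment ND NE) (Glued.linear g , glued-satisfies g (sat-D d∈D) (sat-E e∈E))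

-- Lower bounds for e

AtLeast : Which → ℕ → ℕ → Set
AtLeast w n s = Σ (List (Order n)) λ D → Class w n D × s ≤ length D

atLeast-mono : ∀ w {s s′} → s′ ≤ s → AtLeast w n s → AtLeast w n s′
atLeast-mono w s′≤s (D , cls , s≤D) = D , cls , ≤-trans s′≤s s≤D

atLeast⇒≤ : ∀ w {s m} → IsMaxSize w n m → AtLeast w n s → s ≤ m
atLeast⇒≤ w (_ , maximal) (D , cls , s≤D) = ≤-trans s≤D (maximal D cls)

peakPit⇒class : ∀ w {D : List (Order n)} → IsPeakPit n D → Class w n D
peakPit⇒class fCase = proj₁
peakPit⇒class hCase = λ peakPit → peakPit

atLeast-base : ∀ w → AtLeast w 1 1
atLeast-base w = solutions N , peakPit⇒class w (solutions-isPeakPit N) ,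
  ∈-length (∈-solutions⁺ N {0F ∷ []} (([] ∷ []) , λ { 0F 0F _ () }))
  where
  N : NCAssignment 1
  N _ _ _ = 0F , top

atLeast-glue : ∀ w {k m s t} → 0 < k → 0 < m → AtLeast w k s → AtLeast w m t → AtLeast w (k + m) (2 * s * t)
atLeast-glue fCase {k} {m} 0<k 0<m (D , cond-D , s≤D) (E , cond-E , t≤E) =
  glueDomain D E , glueDomain-condorcet 0<k 0<m cond-D cond-E , size-glueDomain D E s≤D t≤E
  where open Glue k m
atLeast-glue hCase {k} {m} 0<k 0<m (D , (((lins-D , unique-D) , _) , ND , sol-D) , s≤D)
                                   (E , (((lins-E , unique-E) , _) , NE , sol-E) , t≤E) =
  solutions N , solutions-isPeakPit N ,
  ≤-trans (size-glueDomain D E s≤D t≤E)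
          (unique-⊆⇒length≤ (glueDomain-unique 0<k 0<m unique-D unique-E)
                             (glueDomain⊆solutions lins-D lins-E sat-D sat-E))
  where
  open Glue k m
  N = glueAssignment ND NE
  sat-D : ∀ {d} → d ∈ D → Satisfies ND d
  sat-D d∈D = proj₁ (sol-D _ (All.lookup lins-D d∈D)) d∈D
  sat-E : ∀ {e} → e ∈ E → Satisfies NE e
  sat-E e∈E = proj₁ (sol-E _ (All.lookup lins-E e∈E)) e∈E

atLeast-one : ∀ w r → AtLeast w (suc r) 1
atLeast-one w zero    = atLeast-base w
atLeast-one w (suc r) =
  atLeast-mono w (s≤s z≤n) (atLeast-glue w (s≤s z≤n) (s≤s z≤n) (atLeast-base w) (atLeast-one w r))

atLeast-power : ∀ w {k s} → 0 < k → AtLeast w k s → ∀ j r → AtLeast w (j * k + suc r) ((2 * s) ^ j)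
atLeast-power w 0<k g zero    r = atLeast-one w r
atLeast-power w {k} {s} 0<k g (suc j) r =
  subst (λ n → AtLeast w n ((2 * s) ^ suc j)) (sym (+-assoc k (j * k) (suc r)))
  (atLeast-glue w 0<k (<-≤-trans (s≤s z≤n) (m≤n+m (suc r) (j * k))) g (atLeast-power w 0<k g j r))

-- Growth of powers

m^n*[m+n]≤m*[1+m]^n : ∀ m n → m ^ n * (m + n) ≤ m * suc m ^ n
m^n*[m+n]≤m*[1+m]^n m zero    = ≤-reflexive (base m)
  where
  base : ∀ m → 1 * (m + 0) ≡ m * 1
  base = solve-∀
m^n*[m+n]≤m*[1+m]^n m (suc n) = begin
  m * m ^ n * (m + suc n)                  ≡⟨ expand m (m ^ n) n ⟩
  m * (m ^ n * (m + n)) + m ^ n * m        ≤⟨ +-monoʳ-≤ (m * (m ^ n * (m + n))) (*-monoʳ-≤ (m ^ n) (m≤m+n m n)) ⟩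
  m * (m ^ n * (m + n)) + m ^ n * (m + n)  ≡⟨ +-comm (m * (m ^ n * (m + n))) _ ⟩
  suc m * (m ^ n * (m + n))                ≤⟨ *-monoʳ-≤ (suc m) (m^n*[m+n]≤m*[1+m]^n m n) ⟩
  suc m * (m * suc m ^ n)                  ≡⟨ swap m (suc m ^ n) ⟩
  m * (suc m * suc m ^ n)                  ∎
  where
  open ≤-Reasoning
  expand : ∀ m x n → m * x * (m + suc n) ≡ m * (x * (m + n)) + x * m
  expand = solve-∀
  swap : ∀ m y → suc m * (m * y) ≡ m * (suc m * y)
  swap = solve-∀

powers-eventually-dominate : ∀ {A B} → A < B → ∀ C → ∃[ j₀ ] ∀ j → j₀ ≤ j → A ^ j * C < B ^ j
powers-eventually-dominate {zero} {B} 0<B C = 1 , λ { (suc j) _ → m^n>0 B (suc j) }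
  where instance _ = >-nonZero 0<B
-- By Bernoulli's inequality (1 + 1/A)^j ≥ 1 + j/A, the threshold j₀ = A·C suffices.
powers-eventually-dominate {A@(suc _)} {B} A<B C = A * C , dominated
  where
  dominated : ∀ j → A * C ≤ j → A ^ j * C < B ^ j
  dominated j AC≤j = begin-strict
    A ^ j * C          <⟨ *-monoʳ-< (A ^ j) {{m^n≢0 A j}} (n<1+n C) ⟩
    A ^ j * suc C      ≤⟨ *-cancelˡ-≤ A scaled ⟩
    B ^ j              ∎
    where
    open ≤-Reasoning
    scaled : A * (A ^ j * suc C) ≤ A * B ^ j
    scaled = begin
      A * (A ^ j * suc C)  ≡⟨ regroup A (A ^ j) C ⟩
      A ^ j * (A + A * C)  ≤⟨ *-monoʳ-≤ (A ^ j) (+-monoʳ-≤ A AC≤j) ⟩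
      A ^ j * (A + j)      ≤⟨ m^n*[m+n]≤m*[1+m]^n A j ⟩
      A * suc A ^ j        ≤⟨ *-monoʳ-≤ A (^-monoˡ-≤ j A<B) ⟩
      A * B ^ j            ∎
      where
      regroup : ∀ a x c → a * (x * suc c) ≡ x * (a + a * c)
      regroup = solve-∀

^-distribʳ-* : ∀ m n o → (m * n) ^ o ≡ m ^ o * n ^ o
^-distribʳ-* m n zero    = refl
^-distribʳ-* m n (suc o) = trans (cong (m * n *_) (^-distribʳ-* m n o)) (interchange m n (m ^ o) (n ^ o))
  where
  interchange : ∀ m n x y → m * n * (x * y) ≡ m * x * (n * y)
  interchange = solve-∀

powers-eventually-below : ∀ {a b c k} → 0 < b → a ^ k < c * b ^ k →
  ∃[ j₀ ] ∀ j r → j₀ ≤ j → r < k → a ^ (j * k + suc r) < c ^ j * b ^ (j * k + suc r)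
powers-eventually-below {a} {b} {c} {k} 0<b a^k<cb^k
  with j₀ , dominated ← powers-eventually-dominate a^k<cb^k (suc a ^ k) = j₀ , below
  where
  instance _ = >-nonZero 0<b
  below : ∀ j r → j₀ ≤ j → r < k → a ^ (j * k + suc r) < c ^ j * b ^ (j * k + suc r)
  below j r j₀≤j r<k = begin-strict
    a ^ (j * k + suc r)          ≡⟨ ^-distribˡ-+-* a (j * k) (suc r) ⟩
    a ^ (j * k) * a ^ suc r      ≡⟨ cong (_* a ^ suc r) (^-*-comm a j k) ⟩
    (a ^ k) ^ j * a ^ suc r      ≤⟨ *-monoʳ-≤ ((a ^ k) ^ j) a^[1+r]≤[1+a]^k ⟩
    (a ^ k) ^ j * suc a ^ k      <⟨ dominated j j₀≤j ⟩
    (c * b ^ k) ^ j              ≡⟨ ^-distribʳ-* c (b ^ k) j ⟩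
    c ^ j * (b ^ k) ^ j          ≡⟨ cong (c ^ j *_) (^-*-comm b j k) ⟨
    c ^ j * b ^ (j * k)          ≤⟨ *-monoʳ-≤ (c ^ j) (^-monoʳ-≤ b (m≤m+n (j * k) (suc r))) ⟩
    c ^ j * b ^ (j * k + suc r)  ∎
    where
    open ≤-Reasoning
    a^[1+r]≤[1+a]^k : a ^ suc r ≤ suc a ^ k
    a^[1+r]≤[1+a]^k = ≤-trans (^-monoˡ-≤ (suc r) (n≤1+n a)) (^-monoʳ-≤ (suc a) r<k)
    ^-*-comm : ∀ x j k → x ^ (j * k) ≡ (x ^ k) ^ j
    ^-*-comm x j k = trans (cong (x ^_) (*-comm j k)) (sym (^-*-assoc x k j))

pred-divMod : ∀ k .{{_ : NonZero k}} j₀ n → suc (j₀ * k) ≤ n →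
  ∃[ j ] ∃[ r ] n ≡ j * k + suc r × r < k × j₀ ≤ j
pred-divMod k j₀ (suc n) (s≤s j₀k≤n) = n / k , n % k , n≡ , m%n<n n k , j₀≤n/k
  where
  n≡ : suc n ≡ n / k * k + suc (n % k)
  n≡ = trans (cong suc (trans (m≡m%n+[m/n]*n n k) (+-comm (n % k) _))) (sym (+-suc _ _))
  j₀≤n/k : j₀ ≤ n / k
  j₀≤n/k = subst (_≤ n / k) (m*n/n≡m j₀ k) (/-mono-≤ j₀k≤n (≤-refl {k}))

mainTheorem2 : (w : Which) (k : ℕ) → 1 ≤ k → (m : ℕ) → IsMaxSize w k m →
    (a b : ℕ) → 0 < b → a ^ k < 2 * m * b ^ k →
    ∃ λ N → (n : ℕ) → N ≤ n → (m′ : ℕ) → IsMaxSize w n m′ → a ^ n < m′ * b ^ n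
mainTheorem2 w k@(suc _) 0<k m ((D , cls , |D|≡m) , _) a b 0<b a^k<2mb^k
  with j₀ , below ← powers-eventually-below 0<b a^k<2mb^k = suc (j₀ * k) , eventually
  where
  e[k]≥m : AtLeast w k m
  e[k]≥m = D , cls , ≤-reflexive (sym |D|≡m)
  eventually : ∀ n → suc (j₀ * k) ≤ n → ∀ m′ → IsMaxSize w n m′ → a ^ n < m′ * b ^ n
  eventually n n≥ m′ e[n]≡m′ with j , r , refl , r<k , j₀≤j ← pred-divMod k j₀ n n≥ =
    <-≤-trans (below j r j₀≤j r<k) (*-monoˡ-≤ (b ^ n) (atLeast⇒≤ w e[n]≡m′ (atLeast-power w 0<k e[k]≥m j r)))
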